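{- Every (finite) tree is JIS.
   Context: All graphs are finite and simple. A graph $G$ is called JIS if there exist a positive integer $n$ and an assignment of an $n$-element set $S_v$ to each vertex $v$ of $G$ such that distinct vertices receive distinct sets, and for distinct vertices $v,w$, $v$ and $w$ are adjacent iff $|S_v \cap S_w| = n-1$ (equivalently, $G$ is isomorphic to an induced subgraph of a Johnson graph). -}

module Defs where

open import Data.Nat using (ℕ; _≤_; _+_)
open import Data.Nat as ℕ using ()
open import Data.Fin using (Fin; zero; suc; inject₁; fromℕ)
open import Data.Fin.Subset using (Subset; _∩_; ∣_∣)
open import Data.Product using (Σ; _×_; ∃; ∃-syntax)
open import Data.Empty using (⊥)
open import Function.Definitions using (Injective)
open import Relation.Nullary using (¬_)
open import Relation.Binary.PropositionalEquality using (_≡_; _≢_)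

record Graph (k : ℕ) : Set₁ where
  field
    Adj     : Fin k → Fin k → Set
    irrefl  : ∀ {v} → ¬ Adj v v
    sym     : ∀ {v w} → Adj v w → Adj w v

open Graph public

record Walk {k : ℕ} (G : Graph k) (u v : Fin k) : Set where
  field
    len   : ℕ
    vert  : Fin (ℕ.suc len) → Fin k
    start : vert zero ≡ u
    end   : vert (fromℕ len) ≡ v
    steps : ∀ (i : Fin len) → Adj G (vert (inject₁ i)) (vert (suc i))

Connected : {k : ℕ} → Graph k → Set
Connected {k} G = ∀ (u v : Fin k) → Walk G u v

record Cycle {k : ℕ} (G : Graph k) : Set where
  field
    len    : ℕ          -- the cycle has (3 + len) vertices
    vert   : Fin (ℕ.suc (ℕ.suc (ℕ.suc len))) → Fin k
    inj    : Injective _≡_ _≡_ vert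
    steps  : ∀ (i : Fin (ℕ.suc (ℕ.suc len))) → Adj G (vert (inject₁ i)) (vert (suc i))
    close  : Adj G (vert (fromℕ (ℕ.suc (ℕ.suc len)))) (vert zero)

Acyclic : {k : ℕ} → Graph k → Set
Acyclic G = ¬ Cycle G

IsTree : {k : ℕ} → Graph k → Set
IsTree G = Connected G × Acyclic G

record JISRep {k : ℕ} (G : Graph k) : Set where
  field
    n      : ℕ              -- the set size is suc n (positive)
    m      : ℕ
    S      : Fin k → Subset m
    size   : ∀ v → ∣ S v ∣ ≡ ℕ.suc n
    inj    : ∀ v w → v ≢ w → S v ≢ S w
    adj→   : ∀ v w → v ≢ w → Adj G v w → ∣ S v ∩ S w ∣ ≡ n
    adj←   : ∀ v w → v ≢ w → ∣ S v ∩ S w ∣ ≡ n → Adj G v w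

IsJIS : {k : ℕ} → Graph k → Set
IsJIS G = JISRep G

module Submission where

-- A representation of an induced subgraph G[U] consists of (n+1)-element sets
-- S v (v ∈ U) with |S v ∩ S w| = n exactly for the edges, and the separation
-- |S v ∩ S w| ≠ n+1 for distinct v, w.  Such a representation survives the
-- addition of a pendant vertex b hanging at p: the old vertices receive two
-- fresh points as "in, out", b receives them as "out, in" together with S p.
-- Every old intersection grows by one, while |S' b ∩ S' w| = |S p ∩ S w|,
-- which by separation reaches n+1 exactly for w = p.
--
-- For a tree, a connected vertex set U is grown from one vertex: by
-- connectivity some edge p–b leaves U, and by acyclicity b has no second
-- neighbour q in U, since a path from q to p inside U would close a cycle
-- through b.  After at most k steps U contains every vertex.

open import Defs
open import Data.Nat using (ℕ; zero; suc; _≤_; _<_; _+_; s≤s)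
open import Data.Nat.Properties
  using (suc-injective; <⇒≢; <⇒≱; ≤-trans; ≤-reflexive; +-monoʳ-≤; +-suc; m≤m+n)
open import Data.Bool using (if_then_else_)
open import Data.Fin using (Fin; zero; suc; inject₁; fromℕ)
open import Data.Fin.Properties using (_≟_; all?; ¬∀⟶∃¬)
open import Data.Fin.Subset
  using (Subset; inside; outside; _∈_; _∉_; _∩_; _∪_; ⁅_⁆; ∣_∣)
open import Data.Fin.Subset.Properties
  using ( _∈?_; x∈⁅x⁆; x∈⁅y⁆⇒x≡y; x∈p∪q⁻; x∈p∪q⁺; p⊆p∪q; ∈⊤; ∣⊤∣≡n
        ; p⊂q⇒∣p∣<∣q∣; ∣p∩q∣≤∣p∣; ∩-comm; ∩-idem)
open import Data.Vec using (_∷_)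
open import Data.Product using (Σ; ∃; ∃₂; _×_; _,_; proj₁; proj₂)
open import Data.Sum using (_⊎_; inj₁; inj₂)
import Data.Sum as Sum
open import Data.Unit using (⊤; tt)
open import Function using (_∘_)
open import Function.Definitions using (Injective)
open import Relation.Nullary using (¬_; Dec; yes; no; does; contradiction)
open import Relation.Nullary.Decidable using (_⊎-dec_)
open import Relation.Binary.PropositionalEquality
  using (_≡_; _≢_; refl; trans; cong; subst; module ≡-Reasoning)
  renaming (sym to ≡-sym)

open ≡-Reasoning

∈-insert⁻ : ∀ {k} {U : Subset k} {b y : Fin k} → y ∈ U ∪ ⁅ b ⁆ → y ∈ U ⊎ y ≡ b
∈-insert⁻ {U = U} {b} y∈ = Sum.map₂ (x∈⁅y⁆⇒x≡y b) (x∈p∪q⁻ U ⁅ b ⁆ y∈)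

∈-insert-old : ∀ {k} {U : Subset k} {b y : Fin k} → y ∈ U → y ∈ U ∪ ⁅ b ⁆
∈-insert-old {b = b} = p⊆p∪q ⁅ b ⁆

∈-insert-new : ∀ {k} {U : Subset k} (b : Fin k) → b ∈ U ∪ ⁅ b ⁆
∈-insert-new b = x∈p∪q⁺ (inj₂ (x∈⁅x⁆ b))

∣U∣<∣U∪b∣ : ∀ {k} {U : Subset k} {b : Fin k} → b ∉ U → ∣ U ∣ < ∣ U ∪ ⁅ b ⁆ ∣
∣U∣<∣U∪b∣ {b = b} b∉U = p⊂q⇒∣p∣<∣q∣ (∈-insert-old , b , ∈-insert-new b , b∉U)

∣U∣<k : ∀ {k} {U : Subset k} {x : Fin k} → x ∉ U → ∣ U ∣ < k
∣U∣<k {k} {U} {x} x∉U =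
  subst (∣ U ∣ <_) (∣⊤∣≡n k) (p⊂q⇒∣p∣<∣q∣ ((λ _ → ∈⊤) , x , ∈⊤ , x∉U))

module _ {k : ℕ} (G : Graph k) where

  record Faithful {m : ℕ} (S : Fin k → Subset m) (n : ℕ) (v w : Fin k) : Set where
    field
      adj⇒      : Adj G v w → ∣ S v ∩ S w ∣ ≡ n
      ⇒adj      : ∣ S v ∩ S w ∣ ≡ n → Adj G v w
      separated : ∣ S v ∩ S w ∣ ≢ suc n

  faithful-sym : ∀ {m} {S : Fin k → Subset m} {n v w} →
                 Faithful S n v w → Faithful S n w v
  faithful-sym {S = S} {v = v} {w} F = record
    { adj⇒      = λ a → trans swap (adj⇒ (sym G a))
    ; ⇒adj      = λ e → sym G (⇒adj (trans (≡-sym swap) e))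
    ; separated = separated ∘ trans (≡-sym swap)
    }
    where
    open Faithful F
    swap : ∣ S w ∩ S v ∣ ≡ ∣ S v ∩ S w ∣
    swap = cong ∣_∣ (∩-comm (S w) (S v))

  faithful-suc : ∀ {m m'} {S : Fin k → Subset m} {S' : Fin k → Subset m'} {n v w} →
                 ∣ S' v ∩ S' w ∣ ≡ suc ∣ S v ∩ S w ∣ →
                 Faithful S n v w → Faithful S' (suc n) v w
  faithful-suc e F = record
    { adj⇒      = λ a → trans e (cong suc (adj⇒ a))
    ; ⇒adj      = ⇒adj ∘ suc-injective ∘ trans (≡-sym e)
    ; separated = separated ∘ suc-injective ∘ trans (≡-sym e)
    }
    where open Faithful F

  record JISOn (U : Subset k) : Set where
    field
      n m      : ℕ
      S        : Fin k → Subset m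
      size     : ∀ {v} → v ∈ U → ∣ S v ∣ ≡ suc n
      faithful : ∀ {v w} → v ∈ U → w ∈ U → v ≢ w → Faithful S n v w

    self-meet : ∀ {v} → v ∈ U → ∣ S v ∩ S v ∣ ≡ suc n
    self-meet {v} v∈U = trans (cong ∣_∣ (∩-idem (S v))) (size v∈U)

  singletonJIS : ∀ r → JISOn ⁅ r ⁆
  singletonJIS r = record
    { n = 0 ; m = 1 ; S = λ _ → ⁅ zero ⁆ ; size = λ _ → refl
    ; faithful = λ v∈ w∈ v≢w →
        contradiction (trans (x∈⁅y⁆⇒x≡y r v∈) (≡-sym (x∈⁅y⁆⇒x≡y r w∈))) v≢w
    }

  spanning⇒JIS : ∀ {U} → JISOn U → (∀ v → v ∈ U) → JISRep G
  spanning⇒JIS R all∈ = record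
    { n     = n
    ; m     = m
    ; S     = S
    ; size  = λ v → size (all∈ v)
    ; inj   = λ v w v≢w Sv≡Sw → Faithful.separated (pair v w v≢w)
                (trans (cong (λ X → ∣ S v ∩ X ∣) (≡-sym Sv≡Sw)) (self-meet (all∈ v)))
    ; adj→  = λ v w v≢w → Faithful.adj⇒ (pair v w v≢w)
    ; adj←  = λ v w v≢w → Faithful.⇒adj (pair v w v≢w)
    }
    where
    open JISOn R
    pair : ∀ v w → v ≢ w → Faithful S n v w
    pair v w = faithful (all∈ v) (all∈ w)

  record Pendant (U : Subset k) (b p : Fin k) : Set where
    field
      fresh  : b ∉ U
      anchor : p ∈ U
      edge   : Adj G p b
      unique : ∀ {q} → q ∈ U → Adj G b q → q ≡ p

  extendPendant : ∀ {U b p} → Pendant U b p → JISOn U → JISOn (U ∪ ⁅ b ⁆)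
  extendPendant {U} {b} {p} P R = record
    { n = suc n ; m = suc (suc m) ; S = S' ; size = size' ; faithful = faithful' }
    where
    open Pendant P
    open JISOn R

    S' : Fin k → Subset (suc (suc m))
    S' y = if does (y ≟ b) then outside ∷ inside ∷ S p else inside ∷ outside ∷ S y

    S'-new : S' b ≡ outside ∷ inside ∷ S p
    S'-new with b ≟ b
    ... | yes _   = refl
    ... | no b≢b  = contradiction refl b≢b

    S'-old : ∀ {y} → y ∈ U → S' y ≡ inside ∷ outside ∷ S y
    S'-old {y} y∈U with y ≟ b
    ... | yes refl = contradiction y∈U fresh
    ... | no _     = refl

    size' : ∀ {v} → v ∈ U ∪ ⁅ b ⁆ → ∣ S' v ∣ ≡ suc (suc n)
    size' v∈ with ∈-insert⁻ v∈
    ... | inj₁ v∈U = trans (cong ∣_∣ (S'-old v∈U)) (cong suc (size v∈U))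
    ... | inj₂ refl = trans (cong ∣_∣ S'-new) (cong suc (size anchor))

    meet-old : ∀ {v w} → v ∈ U → w ∈ U → ∣ S' v ∩ S' w ∣ ≡ suc ∣ S v ∩ S w ∣
    meet-old v∈U w∈U rewrite S'-old v∈U | S'-old w∈U = refl

    meet-new : ∀ {w} → w ∈ U → ∣ S' b ∩ S' w ∣ ≡ ∣ S p ∩ S w ∣
    meet-new w∈U rewrite S'-new | S'-old w∈U = refl

    -- By separation, p is the only old vertex meeting p in n+1 points.
    only-anchor : ∀ {w} → w ∈ U → ∣ S p ∩ S w ∣ ≡ suc n → w ≡ p
    only-anchor {w} w∈U e with w ≟ p
    ... | yes w≡p = w≡p
    ... | no w≢p  = contradiction e (Faithful.separated (faithful anchor w∈U (w≢p ∘ ≡-sym)))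

    faithful-new : ∀ {w} → w ∈ U → Faithful S' (suc n) b w
    faithful-new {w} w∈U = record
      { adj⇒ = λ b~w → begin
          ∣ S' b ∩ S' w ∣ ≡⟨ meet-new w∈U ⟩
          ∣ S p ∩ S w ∣   ≡⟨ cong (λ q → ∣ S p ∩ S q ∣) (unique w∈U b~w) ⟩
          ∣ S p ∩ S p ∣   ≡⟨ self-meet anchor ⟩
          suc n           ∎
      ; ⇒adj = λ e → subst (Adj G b) (≡-sym (only-anchor w∈U (trans (≡-sym (meet-new w∈U)) e)))
                       (sym G edge)
      ; separated = λ e → <⇒≢ (s≤s (≤-trans (∣p∩q∣≤∣p∣ (S p) (S w)) (≤-reflexive (size anchor))))
                              (trans (≡-sym (meet-new w∈U)) e)
      }

    faithful' : ∀ {v w} → v ∈ U ∪ ⁅ b ⁆ → w ∈ U ∪ ⁅ b ⁆ → v ≢ w → Faithful S' (suc n) v w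
    faithful' v∈ w∈ v≢w with ∈-insert⁻ v∈ | ∈-insert⁻ w∈
    ... | inj₂ refl | inj₂ refl = contradiction refl v≢w
    ... | inj₂ refl | inj₁ w∈U  = faithful-new w∈U
    ... | inj₁ v∈U  | inj₂ refl = faithful-sym (faithful-new v∈U)
    ... | inj₁ v∈U  | inj₁ w∈U  = faithful-suc (meet-old v∈U w∈U) (faithful v∈U w∈U v≢w)

  data WalkIn (U : Subset k) : Fin k → Fin k → Set where
    stop : ∀ {u} → u ∈ U → WalkIn U u u
    step : ∀ {u w v} → u ∈ U → Adj G u w → WalkIn U w v → WalkIn U u v

  weaken : ∀ {U V : Subset k} {u v} → (∀ {y} → y ∈ U → y ∈ V) → WalkIn U u v → WalkIn V u v
  weaken U⊆V (stop u∈) = stop (U⊆V u∈)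
  weaken U⊆V (step u∈ a w) = step (U⊆V u∈) a (weaken U⊆V w)

  _++_ : ∀ {U u v x} → WalkIn U u v → WalkIn U v x → WalkIn U u x
  stop _ ++ w₂ = w₂
  step u∈ a w₁ ++ w₂ = step u∈ a (w₁ ++ w₂)

  ConnectedIn : Subset k → Set
  ConnectedIn U = ∀ {u w} → u ∈ U → w ∈ U → WalkIn U u w

  connectedIn-insert : ∀ {U p b} → ConnectedIn U → p ∈ U → Adj G p b →
                       ConnectedIn (U ∪ ⁅ b ⁆)
  connectedIn-insert {U} {p} {b} conn p∈U p~b u∈ w∈ with ∈-insert⁻ u∈ | ∈-insert⁻ w∈
  ... | inj₂ refl | inj₂ refl = stop (∈-insert-new b)
  ... | inj₂ refl | inj₁ w∈U  = step (∈-insert-new b) (sym G p~b) (weaken ∈-insert-old (conn p∈U w∈U))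
  ... | inj₁ u∈U  | inj₂ refl =
    weaken ∈-insert-old (conn u∈U p∈U) ++ step (∈-insert-old p∈U) p~b (stop (∈-insert-new b))
  ... | inj₁ u∈U  | inj₁ w∈U  = weaken ∈-insert-old (conn u∈U w∈U)

  _onWalk_ : ∀ {U u v} → Fin k → WalkIn U u v → Set
  y onWalk stop {u} _     = y ≡ u
  y onWalk step {u} _ _ w = y ≡ u ⊎ y onWalk w

  onWalk? : ∀ {U u v} (y : Fin k) (w : WalkIn U u v) → Dec (y onWalk w)
  onWalk? y (stop {u} _)     = y ≟ u
  onWalk? y (step {u} _ _ w) = (y ≟ u) ⊎-dec onWalk? y w

  onWalk⇒∈ : ∀ {U u v y} (w : WalkIn U u v) → y onWalk w → y ∈ U
  onWalk⇒∈ (stop u∈) refl = u∈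
  onWalk⇒∈ (step u∈ _ _) (inj₁ refl) = u∈
  onWalk⇒∈ (step _ _ w) (inj₂ y-on) = onWalk⇒∈ w y-on

  IsPath : ∀ {U u v} → WalkIn U u v → Set
  IsPath (stop _)         = ⊤
  IsPath (step {u} _ _ w) = ¬ (u onWalk w) × IsPath w

  suffixFrom : ∀ {U u v y} (w : WalkIn U u v) → IsPath w → y onWalk w →
               Σ (WalkIn U y v) IsPath
  suffixFrom (stop u∈) _ refl = stop u∈ , tt
  suffixFrom (step u∈ a w) path (inj₁ refl) = step u∈ a w , path
  suffixFrom (step _ _ w) (_ , path) (inj₂ y-on) = suffixFrom w path y-on

  toPath : ∀ {U u v} → WalkIn U u v → Σ (WalkIn U u v) IsPath
  toPath (stop u∈) = stop u∈ , tt
  toPath (step {u} u∈ a w) with toPath w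
  ... | π , path with onWalk? u π
  ...   | yes u-on = suffixFrom π path u-on
  ...   | no u-off = step u∈ a π , u-off , path

  walkLength : ∀ {U u v} → WalkIn U u v → ℕ
  walkLength (stop _)     = 0
  walkLength (step _ _ w) = suc (walkLength w)

  vertexAt : ∀ {U u v} (w : WalkIn U u v) → Fin (suc (walkLength w)) → Fin k
  vertexAt (stop {u} _)     _       = u
  vertexAt (step {u} _ _ _) zero    = u
  vertexAt (step _ _ w)     (suc i) = vertexAt w i

  vertexAt-start : ∀ {U u v} (w : WalkIn U u v) → vertexAt w zero ≡ u
  vertexAt-start (stop _)     = refl
  vertexAt-start (step _ _ _) = refl

  vertexAt-end : ∀ {U u v} (w : WalkIn U u v) → vertexAt w (fromℕ (walkLength w)) ≡ v
  vertexAt-end (stop _)     = refl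
  vertexAt-end (step _ _ w) = vertexAt-end w

  vertexAt-adj : ∀ {U u v} (w : WalkIn U u v) (i : Fin (walkLength w)) →
                 Adj G (vertexAt w (inject₁ i)) (vertexAt w (suc i))
  vertexAt-adj (step _ a w) zero    = subst (Adj G _) (≡-sym (vertexAt-start w)) a
  vertexAt-adj (step _ _ w) (suc i) = vertexAt-adj w i

  vertexAt-on : ∀ {U u v} (w : WalkIn U u v) i → vertexAt w i onWalk w
  vertexAt-on (stop _)     _       = refl
  vertexAt-on (step _ _ w) zero    = inj₁ refl
  vertexAt-on (step _ _ w) (suc i) = inj₂ (vertexAt-on w i)

  vertexAt-∉ : ∀ {U u v x} → x ∉ U → (w : WalkIn U u v) → ∀ i → x ≢ vertexAt w i
  vertexAt-∉ x∉U w i x≡ = x∉U (onWalk⇒∈ w (subst (_onWalk w) (≡-sym x≡) (vertexAt-on w i)))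

  vertexAt-injective : ∀ {U u v} (w : WalkIn U u v) → IsPath w → Injective _≡_ _≡_ (vertexAt w)
  vertexAt-injective (stop _)     _          {zero}  {zero}  _ = refl
  vertexAt-injective (step _ _ w) _          {zero}  {zero}  _ = refl
  vertexAt-injective (step _ _ w) (u-off , _) {zero}  {suc j} e =
    contradiction (subst (_onWalk w) (≡-sym e) (vertexAt-on w j)) u-off
  vertexAt-injective (step _ _ w) (u-off , _) {suc i} {zero}  e =
    contradiction (subst (_onWalk w) e (vertexAt-on w i)) u-off
  vertexAt-injective (step _ _ w) (_ , path) {suc i} {suc j} e =
    cong suc (vertexAt-injective w path e)

  -- A vertex x outside U adjacent to both ends of a path inside U with at
  -- least one edge closes a cycle: x, q = W₀, …, W_ℓ = p, back to x.
  closeCycle : ∀ {U x q w p} (q∈ : q ∈ U) (a : Adj G q w) (π : WalkIn U w p) →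
               IsPath (step q∈ a π) → x ∉ U → Adj G x q → Adj G x p → Cycle G
  closeCycle {x = x} q∈ a π path x∉U x~q x~p = record
    { len   = walkLength π
    ; vert  = around
    ; inj   = around-injective
    ; steps = around-steps
    ; close = subst (λ z → Adj G z x) (≡-sym (vertexAt-end W)) (sym G x~p)
    }
    where
    W = step q∈ a π

    around : Fin (suc (suc (suc (walkLength π)))) → Fin k
    around zero    = x
    around (suc i) = vertexAt W i

    around-steps : ∀ i → Adj G (around (inject₁ i)) (around (suc i))
    around-steps zero    = x~q
    around-steps (suc i) = vertexAt-adj W i

    around-injective : Injective _≡_ _≡_ around
    around-injective {zero}  {zero}  _ = refl
    around-injective {zero}  {suc j} e = contradiction e (vertexAt-∉ x∉U W j)
    around-injective {suc i} {zero}  e = contradiction (≡-sym e) (vertexAt-∉ x∉U W i)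
    around-injective {suc i} {suc j} e = cong suc (vertexAt-injective W path e)

  atMostOneNeighbour : ∀ {U x p q} → Acyclic G → ConnectedIn U → x ∉ U →
                       p ∈ U → q ∈ U → Adj G x p → Adj G x q → q ≡ p
  atMostOneNeighbour {p = p} {q} acyclic conn x∉U p∈U q∈U x~p x~q with q ≟ p
  ... | yes q≡p = q≡p
  ... | no q≢p with toPath (conn q∈U p∈U)
  ...   | stop _ , _         = contradiction refl q≢p
  ...   | step q∈ a π , path = contradiction (closeCycle q∈ a π path x∉U x~q x~p) acyclic

  leavingStep : ∀ {U} l (vert : Fin (suc l) → Fin k) → vert zero ∈ U → vert (fromℕ l) ∉ U →
                (∀ i → Adj G (vert (inject₁ i)) (vert (suc i))) →
                ∃₂ λ p b → p ∈ U × b ∉ U × Adj G p b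
  leavingStep zero vert first∈ last∉ _ = contradiction first∈ last∉
  leavingStep {U} (suc l) vert first∈ last∉ steps with vert (suc zero) ∈? U
  ... | yes second∈ = leavingStep l (vert ∘ suc) second∈ last∉ (steps ∘ suc)
  ... | no second∉  = vert zero , vert (suc zero) , first∈ , second∉ , steps zero

  module Growth (connected : Connected G) (acyclic : Acyclic G) where

    record Subtree (U : Subset k) : Set where
      field
        root        : Fin k
        root∈       : root ∈ U
        conn        : ConnectedIn U
        represented : JISOn U

    singletonTree : ∀ r → Subtree ⁅ r ⁆
    singletonTree r = record
      { root = r ; root∈ = x∈⁅x⁆ r ; represented = singletonJIS r
      ; conn = λ u∈ w∈ → subst (WalkIn ⁅ r ⁆ _)
                 (trans (x∈⁅y⁆⇒x≡y r u∈) (≡-sym (x∈⁅y⁆⇒x≡y r w∈))) (stop u∈)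
      }

    growOnce : ∀ {U x} → Subtree U → x ∉ U → ∃ λ b → b ∉ U × Subtree (U ∪ ⁅ b ⁆)
    growOnce {U} {x} T x∉U = b , b∉U , record
      { root = root ; root∈ = ∈-insert-old root∈
      ; conn = connectedIn-insert conn p∈U p~b
      ; represented = extendPendant pendant represented
      }
      where
      open Subtree T
      open Walk (connected root x)
      leaving = leavingStep len vert (subst (_∈ U) (≡-sym start) root∈)
                                     (subst (_∉ U) (≡-sym end) x∉U) steps
      p = proj₁ leaving
      b = proj₁ (proj₂ leaving)
      p∈U = proj₁ (proj₂ (proj₂ leaving))
      b∉U = proj₁ (proj₂ (proj₂ (proj₂ leaving)))
      p~b = proj₂ (proj₂ (proj₂ (proj₂ leaving)))

      pendant : Pendant U b p
      pendant = record
        { fresh = b∉U ; anchor = p∈U ; edge = p~b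
        ; unique = λ q∈U b~q → atMostOneNeighbour acyclic conn b∉U p∈U q∈U (sym G p~b) b~q
        }

    -- Growing with fuel d: while k ≤ d + |U|, the subtree reaches every vertex.
    exhaust : ∀ d {U} → Subtree U → k ≤ d + ∣ U ∣ →
              Σ (Subset k) λ V → JISOn V × (∀ v → v ∈ V)
    exhaust d {U} T bound with all? (_∈? U)
    exhaust d       T bound | yes all∈ = _ , Subtree.represented T , all∈
    exhaust zero    {U} T bound | no ¬all =
      contradiction bound (<⇒≱ (∣U∣<k (proj₂ (¬∀⟶∃¬ k _ (_∈? U) ¬all))))
    exhaust (suc d) {U} T bound | no ¬all with growOnce T (proj₂ (¬∀⟶∃¬ k _ (_∈? U) ¬all))
    ... | b , b∉U , T' = exhaust d T' (≤-trans bound (≤-trans (≤-reflexive (≡-sym (+-suc d ∣ U ∣)))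
                                                               (+-monoʳ-≤ d (∣U∣<∣U∪b∣ b∉U))))

    treeJIS : Fin k → JISRep G
    treeJIS r with exhaust k (singletonTree r) (m≤m+n k ∣ ⁅ r ⁆ ∣)
    ... | _ , R , all∈ = spanning⇒JIS R all∈

mainTheorem7 : ∀ (k : ℕ) (G : Graph k) → IsTree G → IsJIS G
mainTheorem7 zero G _ = record
  { n = 0 ; m = 0 ; S = λ () ; size = λ () ; inj = λ () ; adj→ = λ () ; adj← = λ () }
mainTheorem7 (suc k) G (connected , acyclic) = Growth.treeJIS G connected acyclic zero
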